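{- Let $n\ge 3$, let $I$ be a multiset of $n^2$ positive integers, and let $k=(\sum I)/n$ be the common row/column sum any semi-magic square filled with $I$ must have. Let $G$ be the graph with one vertex for each cell of the $n\times n$ grid, one vertex for each of the $n$ rows and one vertex for each of the $n$ columns, and with an edge between each cell vertex and the vertex of its row and the vertex of its column (and no other edges). Let $S$ be the multiset union of $I$ with $n$ copies of $k-1$ and $n$ copies of $1$. Then the $n\times n$ grid admits a semi-magic square filled with the integers of $I$ if and only if $G$ is $S$-fair with $S$-fairness constant $k$.
   Context: A semi-magic square on an $n\times n$ grid ($n\ge 3$) filled with a multiset $I$ of $n^2$ positive integers is an assignment of the elements of $I$ to the cells, each occurrence of an element of $I$ used in exactly one cell, such that the sum of the integers in each row and in each column is the same. For a graph $G$ and a multiset $S$ of positive integers with $|S|=|V(G)|$, $G$ is $S$-fair with $S$-fairness constant $k$ if there is a bijection $f$ from $V(G)$ to $S$ such that $\sum_{u\in N_G(v)} f(u)=k$ for every vertex $v$, where $N_G(v)$ is the set of neighbours of $v$. -}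

module Defs where

open import Data.Nat using (ℕ; zero; suc; _+_; _*_; _∸_)
open import Data.Bool using (Bool; true; false; if_then_else_; _∧_)
open import Data.Fin using (Fin)
open import Data.Fin.Properties using () renaming (_≟_ to _≟F_)
open import Data.Nat.ListAction using (sum)
open import Data.List using (List; []; _∷_; map; allFin; replicate; _++_; concatMap; length)
open import Data.List.Relation.Unary.All using (All)
open import Data.List.Relation.Binary.Permutation.Propositional using (_↭_)
open import Data.Product using (_×_; _,_; Σ; ∃)
open import Data.Sum using (_⊎_; inj₁; inj₂)
open import Relation.Nullary.Decidable using (⌊_⌋)
open import Relation.Binary.PropositionalEquality using (_≡_)

-- A finite graph, presented by a vertex type, an enumeration listing
-- every vertex exactly once, and a Boolean adjacency relation.
record Graph : Set₁ where
  field
    V    : Set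
    enum : List V
    adj  : V → V → Bool

neighbourSum : (G : Graph) → (Graph.V G → ℕ) → Graph.V G → ℕ
neighbourSum G f v = sum (map (λ u → if Graph.adj G v u then f u else 0) (Graph.enum G))

-- G is S-fair with S-fairness constant k: a bijection f from V(G) to the
-- multiset S (a list; since enum lists each vertex once, f is a bijection
-- onto the occurrences of S iff the values of f over enum are a
-- permutation of S) such that every neighbourhood sum equals k.
IsFair : (G : Graph) → (S : List ℕ) → (k : ℕ) → Set
IsFair G S k = Σ (Graph.V G → ℕ) λ f →
  (map f (Graph.enum G) ↭ S) × (∀ v → neighbourSum G f v ≡ k)

entries : (n : ℕ) → (Fin n → Fin n → ℕ) → List ℕ
entries n sq = concatMap (λ i → map (λ j → sq i j) (allFin n)) (allFin n)

rowSum : (n : ℕ) → (Fin n → Fin n → ℕ) → Fin n → ℕ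
rowSum n sq i = sum (map (λ j → sq i j) (allFin n))

colSum : (n : ℕ) → (Fin n → Fin n → ℕ) → Fin n → ℕ
colSum n sq j = sum (map (λ i → sq i j) (allFin n))

SemiMagic : (n : ℕ) → (I : List ℕ) → Set
SemiMagic n I = Σ (Fin n → Fin n → ℕ) λ sq →
  (entries n sq ↭ I) ×
  ∃ λ s → (∀ i → rowSum n sq i ≡ s) × (∀ j → colSum n sq j ≡ s)

GridV : ℕ → Set
GridV n = (Fin n × Fin n) ⊎ (Fin n ⊎ Fin n)

gridEnum : (n : ℕ) → List (GridV n)
gridEnum n =
  map inj₁ (concatMap (λ i → map (λ j → (i , j)) (allFin n)) (allFin n))
  ++ (map (λ i → inj₂ (inj₁ i)) (allFin n) ++ map (λ j → inj₂ (inj₂ j)) (allFin n))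

gridAdj : (n : ℕ) → GridV n → GridV n → Bool
gridAdj n (inj₁ (i , j)) (inj₂ (inj₁ r)) = ⌊ i ≟F r ⌋
gridAdj n (inj₁ (i , j)) (inj₂ (inj₂ c)) = ⌊ j ≟F c ⌋
gridAdj n (inj₂ (inj₁ r)) (inj₁ (i , j)) = ⌊ i ≟F r ⌋
gridAdj n (inj₂ (inj₂ c)) (inj₁ (i , j)) = ⌊ j ≟F c ⌋
gridAdj n _ _ = false

gridGraph : ℕ → Graph
gridGraph n = record { V = GridV n ; enum = gridEnum n ; adj = gridAdj n }

fairMultiset : ℕ → List ℕ → ℕ → List ℕ
fairMultiset n I k = I ++ (replicate n (k ∸ 1) ++ replicate n 1)

-- A fair labelling forces every cell vertex to see row label + column label = k, so all row
-- vertices carry one label a and all column vertices one label b with a + b = k, and the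
-- row and column vertex sums are exactly the row and column sums of the square on the cells.
-- If {a, b} = {k - 1, 1} the cells carry exactly I.  Otherwise all n copies of k - 1 sit on
-- cells; the n² positive cell values then sum to at least n² + n(k - 2), while the n rows
-- sum to nk, forcing n ≤ 2.
module Submission where

open import Defs
open import Data.Nat using (ℕ; _*_; _≤_; _<_)
open import Data.Nat.Divisibility using (_∣_; quotient)
open import Data.Nat.ListAction using (sum)
open import Data.List using (List; length)
open import Data.List.Relation.Unary.All using (All)
open import Function.Bundles using (_⇔_)
open import Relation.Binary.PropositionalEquality using (_≡_)

open import Data.Nat using (zero; suc; _+_; NonZero; z≤n; s≤s)
open import Data.Nat.Properties hiding (suc-injective)
open import Data.Nat.Divisibility using (divides)
open import Algebra.Properties.CommutativeSemigroup +-commutativeSemigroup using (x∙yz≈y∙xz)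
open import Data.Nat.ListAction.Properties using (sum-++; sum-↭)
open import Data.Bool using (if_then_else_)
open import Data.Fin using (Fin; zero; suc)
open import Data.Fin.Properties using (suc-injective) renaming (_≟_ to _≟F_)
open import Data.List using ([]; _∷_; map; allFin; replicate; _++_; concatMap; filter)
open import Data.List.Properties
  using (map-++; map-∘; map-cong; map-tabulate; map-concatMap; concatMap-cong; length-++;
         length-map; length-tabulate; length-replicate; filter-++; filter-all; filter-none; filter-accept; filter-reject)
open import Data.List.Relation.Unary.All using ([]; _∷_)
import Data.List.Relation.Unary.All.Properties as All
open import Data.List.Relation.Binary.Permutation.Propositional using (_↭_; ↭-sym; ↭-trans; ↭-reflexive)
open import Data.List.Relation.Binary.Permutation.Propositional.Properties
  using (++⁺ˡ; ++⁺ʳ; ++-comm; drop-mid; ↭-length; filter-↭; All-resp-↭)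
open import Data.Product using (_,_)
open import Data.Sum using (_⊎_; inj₁; inj₂)
open import Data.Empty using (⊥-elim)
open import Function using (_∘_)
open import Function.Bundles using (mk⇔)
open import Relation.Nullary using (yes; no)
open import Relation.Nullary.Decidable using (⌊_⌋; isYes≗does; dec-true; dec-false)
open import Relation.Binary.PropositionalEquality using (_≢_; refl; sym; trans; cong; cong₂; module ≡-Reasoning)

private
  variable
    A B : Set
    n : ℕ

sum-map-≡0 : {F : A → ℕ} → (∀ x → F x ≡ 0) → (xs : List A) → sum (map F xs) ≡ 0
sum-map-≡0 F≡0 []       = refl
sum-map-≡0 F≡0 (x ∷ xs) = cong₂ _+_ (F≡0 x) (sum-map-≡0 F≡0 xs)

sum-map-cong : {F G : A → ℕ} → (∀ x → F x ≡ G x) → (xs : List A) → sum (map F xs) ≡ sum (map G xs)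
sum-map-cong F≡G xs = cong sum (map-cong F≡G xs)

sum-concatMap : (h : A → List ℕ) (xs : List A) → sum (concatMap h xs) ≡ sum (map (sum ∘ h) xs)
sum-concatMap h []       = refl
sum-concatMap h (x ∷ xs) = trans (sum-++ (h x) (concatMap h xs)) (cong (sum (h x) +_) (sum-concatMap h xs))

length-concatMap : (h : A → List B) (xs : List A) → length (concatMap h xs) ≡ sum (map (length ∘ h) xs)
length-concatMap h []       = refl
length-concatMap h (x ∷ xs) = trans (length-++ (h x)) (cong (length (h x) +_) (length-concatMap h xs))

sum-replicate : ∀ n c → sum (replicate n c) ≡ n * c
sum-replicate zero    c = refl
sum-replicate (suc n) c = cong (c +_) (sum-replicate n c)

length≤sum : {xs : List ℕ} → All (λ x → 0 < x) xs → length xs ≤ sum xs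
length≤sum []         = z≤n
length≤sum (x>0 ∷ xs>0) = +-mono-≤ x>0 (length≤sum xs>0)

map-allFin-suc : (g : Fin (suc n) → A) → map g (allFin (suc n)) ≡ g zero ∷ map (g ∘ suc) (allFin n)
map-allFin-suc g = trans (map-tabulate (λ i → i) g) (cong (g zero ∷_) (sym (map-tabulate (λ i → i) (g ∘ suc))))

map-allFin-const : {g : Fin n → A} {c : A} → (∀ i → g i ≡ c) → map g (allFin n) ≡ replicate n c
map-allFin-const {n = zero}  g≡c = refl
map-allFin-const {n = suc n} g≡c = trans (map-allFin-suc _) (cong₂ _∷_ (g≡c zero) (map-allFin-const (g≡c ∘ suc)))

sum-allFin-const : {g : Fin n → ℕ} {c : ℕ} → (∀ i → g i ≡ c) → sum (map g (allFin n)) ≡ n * c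
sum-allFin-const {n = n} {c = c} g≡c = trans (cong sum (map-allFin-const g≡c)) (sum-replicate n c)

sum-allFin-δ : (g : Fin n → ℕ) (i : Fin n) → (∀ r → r ≢ i → g r ≡ 0) → sum (map g (allFin n)) ≡ g i
sum-allFin-δ {suc n} g zero g≡0 = begin
  sum (map g (allFin (suc n)))             ≡⟨ cong sum (map-allFin-suc g) ⟩
  g zero + sum (map (g ∘ suc) (allFin n))  ≡⟨ cong (g zero +_) (sum-map-≡0 (λ r → g≡0 (suc r) λ ()) (allFin n)) ⟩
  g zero + 0                               ≡⟨ +-identityʳ (g zero) ⟩
  g zero                                   ∎
  where open ≡-Reasoning
sum-allFin-δ {suc n} g (suc i) g≡0 = begin
  sum (map g (allFin (suc n)))             ≡⟨ cong sum (map-allFin-suc g) ⟩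
  g zero + sum (map (g ∘ suc) (allFin n))  ≡⟨ cong₂ _+_ (g≡0 zero λ ()) (sum-allFin-δ (g ∘ suc) i (λ r r≢i → g≡0 (suc r) (r≢i ∘ suc-injective))) ⟩
  g (suc i)                                ∎
  where open ≡-Reasoning

if-≟-refl : (i : Fin n) {x y : A} → (if ⌊ i ≟F i ⌋ then x else y) ≡ x
if-≟-refl i {x} {y} = cong (λ b → if b then x else y) (trans (isYes≗does (i ≟F i)) (dec-true (i ≟F i) refl))

if-≟-≢ : {i r : Fin n} {x y : A} → i ≢ r → (if ⌊ i ≟F r ⌋ then x else y) ≡ y
if-≟-≢ {i = i} {r} {x} {y} i≢r = cong (λ b → if b then x else y) (trans (isYes≗does (i ≟F r)) (dec-false (i ≟F r) i≢r))

sum-entries : (sq : Fin n → Fin n → ℕ) → sum (entries n sq) ≡ sum (map (rowSum n sq) (allFin n))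
sum-entries {n} sq = sum-concatMap _ (allFin n)

sum-entries-rows : (sq : Fin n → Fin n → ℕ) {s : ℕ} → (∀ i → rowSum n sq i ≡ s) → sum (entries n sq) ≡ n * s
sum-entries-rows sq rows = trans (sum-entries sq) (sum-allFin-const rows)

length-entries : (sq : Fin n → Fin n → ℕ) → length (entries n sq) ≡ n * n
length-entries {n} sq = trans (length-concatMap _ (allFin n))
  (sum-allFin-const (λ i → trans (length-map (sq i) (allFin n)) (length-tabulate (λ j → j))))

pattern cell i j = inj₁ (i , j)
pattern row i    = inj₂ (inj₁ i)
pattern col j    = inj₂ (inj₂ j)

cellLabels : (GridV n → A) → Fin n → Fin n → A
cellLabels f i j = f (cell i j)

map-gridEnum : (F : GridV n → A) →
  map F (gridEnum n) ≡
  concatMap (λ i → map (cellLabels F i) (allFin n)) (allFin n) ++ (map (F ∘ row) (allFin n) ++ map (F ∘ col) (allFin n))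
map-gridEnum {n} F = begin
  map F (gridEnum n)
    ≡⟨ map-++ F (map inj₁ cells) _ ⟩
  map F (map inj₁ cells) ++ map F (map row (allFin n) ++ map col (allFin n))
    ≡⟨ cong₂ _++_ (sym (map-∘ cells)) (map-++ F (map row (allFin n)) _) ⟩
  map (F ∘ inj₁) cells ++ (map F (map row (allFin n)) ++ map F (map col (allFin n)))
    ≡⟨ cong₂ _++_ cellPart (cong₂ _++_ (sym (map-∘ (allFin n))) (sym (map-∘ (allFin n)))) ⟩
  concatMap (λ i → map (cellLabels F i) (allFin n)) (allFin n) ++ (map (F ∘ row) (allFin n) ++ map (F ∘ col) (allFin n))
    ∎
  where
  open ≡-Reasoning
  cells = concatMap (λ i → map (i ,_) (allFin n)) (allFin n)
  cellPart : map (F ∘ inj₁) cells ≡ concatMap (λ i → map (cellLabels F i) (allFin n)) (allFin n)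
  cellPart = trans (map-concatMap (F ∘ inj₁) _ (allFin n)) (concatMap-cong (λ i → sym (map-∘ (allFin n))) (allFin n))

map-gridEnum-labels : (f : GridV n → ℕ) {a b : ℕ} → (∀ i → f (row i) ≡ a) → (∀ j → f (col j) ≡ b) →
  map f (gridEnum n) ≡ entries n (cellLabels f) ++ (replicate n a ++ replicate n b)
map-gridEnum-labels {n} f rows cols =
  trans (map-gridEnum f) (cong (entries n (cellLabels f) ++_) (cong₂ _++_ (map-allFin-const rows) (map-allFin-const cols)))

sum-gridEnum : (F : GridV n → ℕ) →
  sum (map F (gridEnum n)) ≡
  sum (map (rowSum n (cellLabels F)) (allFin n)) + (sum (map (F ∘ row) (allFin n)) + sum (map (F ∘ col) (allFin n)))
sum-gridEnum {n} F = begin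
  sum (map F (gridEnum n))
    ≡⟨ cong sum (map-gridEnum F) ⟩
  sum (entries n (cellLabels F) ++ (map (F ∘ row) (allFin n) ++ map (F ∘ col) (allFin n)))
    ≡⟨ sum-++ (entries n (cellLabels F)) _ ⟩
  sum (entries n (cellLabels F)) + sum (map (F ∘ row) (allFin n) ++ map (F ∘ col) (allFin n))
    ≡⟨ cong₂ _+_ (sum-entries (cellLabels F)) (sum-++ (map (F ∘ row) (allFin n)) _) ⟩
  sum (map (rowSum n (cellLabels F)) (allFin n)) + (sum (map (F ∘ row) (allFin n)) + sum (map (F ∘ col) (allFin n)))
    ∎
  where open ≡-Reasoning

module _ {n : ℕ} (f : GridV n → ℕ) where

  private
    weight : GridV n → GridV n → ℕ
    weight v u = if gridAdj n v u then f u else 0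

  neighbourSum-cell : ∀ i j → neighbourSum (gridGraph n) f (cell i j) ≡ f (row i) + f (col j)
  neighbourSum-cell i j = begin
    neighbourSum (gridGraph n) f (cell i j)
      ≡⟨ sum-gridEnum (weight (cell i j)) ⟩
    sum (map (λ _ → sum (map (λ _ → 0) (allFin n))) (allFin n)) + (rowPart + colPart)
      ≡⟨ cong (_+ (rowPart + colPart)) (sum-map-≡0 (λ _ → sum-map-≡0 (λ _ → refl) (allFin n)) (allFin n)) ⟩
    rowPart + colPart
      ≡⟨ cong₂ _+_ (sum-allFin-δ _ i (λ r r≢i → if-≟-≢ (r≢i ∘ sym))) (sum-allFin-δ _ j (λ c c≢j → if-≟-≢ (c≢j ∘ sym))) ⟩
    weight (cell i j) (row i) + weight (cell i j) (col j)
      ≡⟨ cong₂ _+_ (if-≟-refl i) (if-≟-refl j) ⟩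
    f (row i) + f (col j)
      ∎
    where
    open ≡-Reasoning
    rowPart = sum (map (weight (cell i j) ∘ row) (allFin n))
    colPart = sum (map (weight (cell i j) ∘ col) (allFin n))

  private
    noLineNeighbours : (v : Fin n ⊎ Fin n) →
      sum (map (weight (inj₂ v) ∘ row) (allFin n)) + sum (map (weight (inj₂ v) ∘ col) (allFin n)) ≡ 0
    noLineNeighbours (inj₁ _) = cong₂ _+_ (sum-map-≡0 (λ _ → refl) (allFin n)) (sum-map-≡0 (λ _ → refl) (allFin n))
    noLineNeighbours (inj₂ _) = cong₂ _+_ (sum-map-≡0 (λ _ → refl) (allFin n)) (sum-map-≡0 (λ _ → refl) (allFin n))

  neighbourSum-row : ∀ r → neighbourSum (gridGraph n) f (row r) ≡ rowSum n (cellLabels f) r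
  neighbourSum-row r = begin
    neighbourSum (gridGraph n) f (row r)
      ≡⟨ sum-gridEnum (weight (row r)) ⟩
    sum (map (rowSum n (cellLabels (weight (row r)))) (allFin n)) + _
      ≡⟨ cong₂ _+_ (sum-allFin-δ _ r otherRow) (noLineNeighbours (inj₁ r)) ⟩
    rowSum n (cellLabels (weight (row r))) r + 0
      ≡⟨ +-identityʳ _ ⟩
    rowSum n (cellLabels (weight (row r))) r
      ≡⟨ sum-map-cong (λ _ → if-≟-refl r) (allFin n) ⟩
    rowSum n (cellLabels f) r
      ∎
    where
    open ≡-Reasoning
    otherRow : ∀ i → i ≢ r → rowSum n (cellLabels (weight (row r))) i ≡ 0
    otherRow i i≢r = sum-map-≡0 (λ _ → if-≟-≢ i≢r) (allFin n)

  neighbourSum-col : ∀ c → neighbourSum (gridGraph n) f (col c) ≡ colSum n (cellLabels f) c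
  neighbourSum-col c = begin
    neighbourSum (gridGraph n) f (col c)
      ≡⟨ sum-gridEnum (weight (col c)) ⟩
    sum (map (rowSum n (cellLabels (weight (col c)))) (allFin n)) + _
      ≡⟨ cong₂ _+_ (sum-map-cong entryInColumn (allFin n)) (noLineNeighbours (inj₂ c)) ⟩
    colSum n (cellLabels f) c + 0
      ≡⟨ +-identityʳ _ ⟩
    colSum n (cellLabels f) c
      ∎
    where
    open ≡-Reasoning
    entryInColumn : ∀ i → rowSum n (cellLabels (weight (col c))) i ≡ f (cell i c)
    entryInColumn i = trans (sum-allFin-δ _ c (λ j j≢c → if-≟-≢ j≢c)) (if-≟-refl c)

count : ℕ → List ℕ → ℕ
count c xs = length (filter (_≟ c) xs)

count-++ : ∀ c (xs ys : List ℕ) → count c (xs ++ ys) ≡ count c xs + count c ys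
count-++ c xs ys = trans (cong length (filter-++ (_≟ c) xs ys)) (length-++ (filter (_≟ c) xs))

count-++₃ : ∀ c (xs ys zs : List ℕ) → count c (xs ++ (ys ++ zs)) ≡ count c xs + (count c ys + count c zs)
count-++₃ c xs ys zs = trans (count-++ c xs (ys ++ zs)) (cong (count c xs +_) (count-++ c ys zs))

count-↭ : ∀ c {xs ys : List ℕ} → xs ↭ ys → count c xs ≡ count c ys
count-↭ c xs↭ys = ↭-length (filter-↭ (_≟ c) xs↭ys)

count-replicate : ∀ n c → count c (replicate n c) ≡ n
count-replicate n c = trans (cong length (filter-all (_≟ c) (All.replicate⁺ n refl))) (length-replicate n)

count-replicate-≢ : ∀ n {x c} → x ≢ c → count c (replicate n x) ≡ 0
count-replicate-≢ n {c = c} x≢c = cong length (filter-none (_≟ c) (All.replicate⁺ n x≢c))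

count-∷-≡ : ∀ c (xs : List ℕ) → count c (c ∷ xs) ≡ suc (count c xs)
count-∷-≡ c xs = cong length (filter-accept (_≟ c) refl)

count-∷-≢ : ∀ {x c} (xs : List ℕ) → x ≢ c → count c (x ∷ xs) ≡ count c xs
count-∷-≢ {c = c} xs x≢c = cong length (filter-reject (_≟ c) x≢c)

-- Each occurrence of suc d weighs d more than the 1 that positivity guarantees.
length+count*≤sum : ∀ d {xs} → All (λ x → 0 < x) xs → length xs + count (suc d) xs * d ≤ sum xs
length+count*≤sum d [] = z≤n
length+count*≤sum d {x ∷ xs} (x>0 ∷ xs>0) with x ≟ suc d
... | yes refl = begin
  suc (length xs) + count (suc d) (suc d ∷ xs) * d  ≡⟨ cong (λ m → suc (length xs) + m * d) (count-∷-≡ (suc d) xs) ⟩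
  suc (length xs + (d + count (suc d) xs * d))      ≡⟨ cong suc (x∙yz≈y∙xz (length xs) d _) ⟩
  suc (d + (length xs + count (suc d) xs * d))      ≤⟨ s≤s (+-monoʳ-≤ d (length+count*≤sum d xs>0)) ⟩
  suc d + sum xs                                    ∎
  where open ≤-Reasoning
... | no x≢1+d = begin
  suc (length xs) + count (suc d) (x ∷ xs) * d      ≡⟨ cong (λ m → suc (length xs) + m * d) (count-∷-≢ xs x≢1+d) ⟩
  1 + (length xs + count (suc d) xs * d)            ≤⟨ +-mono-≤ x>0 (length+count*≤sum d xs>0) ⟩
  x + sum xs                                        ∎
  where open ≤-Reasoning

++-cancelˡ : (xs : List A) {ys zs : List A} → xs ++ ys ↭ xs ++ zs → ys ↭ zs
++-cancelˡ []       p = p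
++-cancelˡ (x ∷ xs) p = ++-cancelˡ xs (drop-mid [] [] p)

++-cancelʳ : {xs ys : List A} (zs : List A) → xs ++ zs ↭ ys ++ zs → xs ↭ ys
++-cancelʳ {xs = xs} {ys} zs p = ++-cancelˡ zs (↭-trans (++-comm zs xs) (↭-trans p (++-comm ys zs)))

count-labels : ∀ {E I : List ℕ} {a b c} →
  E ++ (replicate n a ++ replicate n b) ↭ I ++ (replicate n c ++ replicate n 1) →
  a ≢ c → b ≢ c → n ≤ count c E
count-labels {n} {E} {I} {a} {b} {c} p a≢c b≢c = begin
  n                                                        ≤⟨ m≤n+m n (count c I) ⟩
  count c I + n                                            ≤⟨ +-monoʳ-≤ (count c I) (m≤m+n n _) ⟩
  count c I + (n + count c (replicate n 1))                ≡⟨ cong (λ m → count c I + (m + count c (replicate n 1))) (count-replicate n c) ⟨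
  count c I + (count c (replicate n c) + count c (replicate n 1)) ≡⟨ count-++₃ c I (replicate n c) (replicate n 1) ⟨
  count c (I ++ (replicate n c ++ replicate n 1))          ≡⟨ count-↭ c (↭-sym p) ⟩
  count c (E ++ (replicate n a ++ replicate n b))          ≡⟨ count-++₃ c E (replicate n a) (replicate n b) ⟩
  count c E + (count c (replicate n a) + count c (replicate n b)) ≡⟨ cong (count c E +_) (cong₂ _+_ (count-replicate-≢ n {a} a≢c) (count-replicate-≢ n {b} b≢c)) ⟩
  count c E + 0                                            ≡⟨ +-identityʳ (count c E) ⟩
  count c E                                                ∎
  where
  open ≤-Reasoning

cancel-labels : ∀ {E I : List ℕ} {a b c} → a + b ≡ suc c →
  E ++ (replicate n a ++ replicate n b) ↭ I ++ (replicate n c ++ replicate n 1) →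
  E ↭ I ⊎ n ≤ count c E
cancel-labels {n} {E} {I} {a} {b} {c} a+b≡1+c p with a ≟ c | b ≟ c
... | yes refl | _ = inj₁ (++-cancelʳ _ (↭-trans p′ p))
  where
  b≡1 : b ≡ 1
  b≡1 = +-cancelˡ-≡ a b 1 (trans a+b≡1+c (+-comm 1 a))
  p′ : E ++ (replicate n a ++ replicate n 1) ↭ E ++ (replicate n a ++ replicate n b)
  p′ = ↭-reflexive (cong (λ x → E ++ (replicate n a ++ replicate n x)) (sym b≡1))
... | no _ | yes refl = inj₁ (++-cancelʳ _ (↭-trans p′ p))
  where
  a≡1 : a ≡ 1
  a≡1 = +-cancelʳ-≡ b a 1 a+b≡1+c
  p′ : E ++ (replicate n b ++ replicate n 1) ↭ E ++ (replicate n a ++ replicate n b)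
  p′ = ↭-trans (++⁺ˡ E (++-comm (replicate n b) (replicate n 1)))
               (↭-reflexive (cong (λ x → E ++ (replicate n x ++ replicate n b)) (sym a≡1)))
... | no a≢c | no b≢c = inj₂ (count-labels {E = E} {I} p a≢c b≢c)

crowded⇒≤2 : ∀ {n d} {E : List ℕ} → All (λ x → 0 < x) E → length E ≡ n * n →
  sum E ≡ n * suc (suc d) → n ≤ count (suc d) E → n ≤ 2
crowded⇒≤2 {zero}      _ _ _ _ = z≤n
crowded⇒≤2 {n@(suc _)} {d} {E} E>0 |E| ΣE crowded = *-cancelˡ-≤ n (+-cancelʳ-≤ (n * d) (n * n) (n * 2) (begin
  n * n + n * d                    ≤⟨ +-monoʳ-≤ (n * n) (*-monoˡ-≤ d crowded) ⟩
  n * n + count (suc d) E * d      ≡⟨ cong (_+ count (suc d) E * d) |E| ⟨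
  length E + count (suc d) E * d   ≤⟨ length+count*≤sum d E>0 ⟩
  sum E                            ≡⟨ ΣE ⟩
  n * (2 + d)                      ≡⟨ *-distribˡ-+ n 2 d ⟩
  n * 2 + n * d                    ∎))
  where open ≤-Reasoning

semiMagic⇒fair : ∀ {n} .{{_ : NonZero n}} {I c} → sum I ≡ suc c * n →
  SemiMagic n I → IsFair (gridGraph n) (fairMultiset n I (suc c)) (suc c)
semiMagic⇒fair {n} {I} {c} ΣI (sq , sq↭I , s , rows , cols) = f , f↭S , fair
  where
  f : GridV n → ℕ
  f (cell i j) = sq i j
  f (row _)    = c
  f (col _)    = 1
  s≡k : s ≡ suc c
  s≡k = *-cancelˡ-≡ s (suc c) n (begin
    n * s              ≡⟨ sum-entries-rows sq rows ⟨
    sum (entries n sq) ≡⟨ sum-↭ sq↭I ⟩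
    sum I              ≡⟨ ΣI ⟩
    suc c * n          ≡⟨ *-comm (suc c) n ⟩
    n * suc c          ∎)
    where open ≡-Reasoning
  f↭S : map f (gridEnum n) ↭ fairMultiset n I (suc c)
  f↭S = ↭-trans (↭-reflexive (map-gridEnum-labels f (λ _ → refl) (λ _ → refl))) (++⁺ʳ _ sq↭I)
  fair : ∀ v → neighbourSum (gridGraph n) f v ≡ suc c
  fair (cell i j) = trans (neighbourSum-cell f i j) (+-comm c 1)
  fair (row i)    = trans (neighbourSum-row f i) (trans (rows i) s≡k)
  fair (col j)    = trans (neighbourSum-col f j) (trans (cols j) s≡k)

fair⇒semiMagic : ∀ {n I d} → 3 ≤ n → All (λ x → 0 < x) I →
  IsFair (gridGraph n) (fairMultiset n I (suc (suc d))) (suc (suc d)) → SemiMagic n I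
fair⇒semiMagic {n@(suc _)} {I} {d} 3≤n I>0 (f , f↭S , fair) = sq , sq↭I , k , rows , cols
  where
  k = suc (suc d)
  sq = cellLabels f
  rows : ∀ i → rowSum n sq i ≡ k
  rows i = trans (sym (neighbourSum-row f i)) (fair (row i))
  cols : ∀ j → colSum n sq j ≡ k
  cols j = trans (sym (neighbourSum-col f j)) (fair (col j))
  a = f (row zero)
  b = f (col zero)
  labels : ∀ i j → f (row i) + f (col j) ≡ k
  labels i j = trans (sym (neighbourSum-cell f i j)) (fair (cell i j))
  rowLabel : ∀ i → f (row i) ≡ a
  rowLabel i = +-cancelʳ-≡ b (f (row i)) a (trans (labels i zero) (sym (labels zero zero)))
  colLabel : ∀ j → f (col j) ≡ b
  colLabel j = +-cancelˡ-≡ a (f (col j)) b (trans (labels zero j) (sym (labels zero zero)))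
  sq↭S : entries n sq ++ (replicate n a ++ replicate n b) ↭ fairMultiset n I k
  sq↭S = ↭-trans (↭-reflexive (sym (map-gridEnum-labels f rowLabel colLabel))) f↭S
  sq>0 : All (λ x → 0 < x) (entries n sq)
  sq>0 = All.++⁻ˡ (entries n sq) (All-resp-↭ (↭-sym sq↭S)
           (All.++⁺ I>0 (All.++⁺ (All.replicate⁺ n (s≤s z≤n)) (All.replicate⁺ n (s≤s z≤n)))))
  sq↭I : entries n sq ↭ I
  sq↭I with cancel-labels (labels zero zero) sq↭S
  ... | inj₁ sq↭I    = sq↭I
  ... | inj₂ crowded = ⊥-elim (<⇒≱ 3≤n
          (crowded⇒≤2 sq>0 (length-entries sq) (sum-entries-rows sq rows) crowded))

mainTheorem12 : (n : ℕ) → 3 ≤ n → (I : List ℕ) → length I ≡ n * n → All (λ x → 0 < x) I →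
    (n∣ΣI : n ∣ sum I) →
    SemiMagic n I ⇔ IsFair (gridGraph n) (fairMultiset n I (quotient n∣ΣI)) (quotient n∣ΣI)
mainTheorem12 n@(suc _) 3≤n I |I| I>0 (divides k ΣI) = semiMagic⇔fair (≤-trans 3≤n n≤k)
  where
  n≤k : n ≤ k
  n≤k = *-cancelʳ-≤ n k n (begin
    n * n    ≡⟨ |I| ⟨
    length I ≤⟨ length≤sum I>0 ⟩
    sum I    ≡⟨ ΣI ⟩
    k * n    ∎)
    where open ≤-Reasoning
  semiMagic⇔fair : 3 ≤ k → SemiMagic n I ⇔ IsFair (gridGraph n) (fairMultiset n I k) k
  semiMagic⇔fair (s≤s (s≤s _)) = mk⇔ (semiMagic⇒fair ΣI) (fair⇒semiMagic 3≤n I>0)
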